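{- There is an absolute constant $C$ such that for all positive integers $n$ and $k$ there is a CNF encoding of $\mathsf{AtMostK}(x_1,\dots,x_n)$ using at most $2n + C k n^{k/(k+1)}$ clauses and at most $C k n^{k/(k+1)}$ auxiliary variables.
   Context: $\mathsf{AtMostK}(x_1,\dots,x_n)$ is true iff at most $k$ of $x_1,\dots,x_n$ are true. A CNF formula is a set of clauses; its size is its number of clauses. For a partial assignment $\tau$, $\varphi|_\tau$ deletes clauses satisfied by $\tau$ and literals falsified by $\tau$. A CNF $\varphi$ over $X\sqcup Y$, $X=(x_1,\dots,x_n)$, encodes $f$ if for every assignment $\tau$ of $X$, $f(\tau)=\top$ iff $\varphi|_\tau$ is satisfiable; variables in $Y$ are auxiliary. -}

module Defs where

open import Data.Nat using (ℕ; zero; suc; _+_; _≤_)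
open import Data.Fin using (Fin; zero; suc)
open import Data.Bool using (Bool; true; false; not; if_then_else_; T)
open import Data.Sum using (_⊎_; inj₁; inj₂)
open import Data.List using (List; []; _∷_; length)
open import Data.List.Relation.Unary.All using (All)
open import Data.List.Relation.Unary.Any using (Any)
open import Data.Product using (Σ; ∃; _×_)
open import Function using (_∘_)

data Lit (V : Set) : Set where
  pos : V → Lit V
  neg : V → Lit V

Clause : Set → Set
Clause V = List (Lit V)

-- A CNF formula as a list of clauses; its size is the length of the list
-- (which is at least the number of distinct clauses).
CNF : Set → Set
CNF V = List (Clause V)

size : {V : Set} → CNF V → ℕ
size = length

Assignment : Set → Set
Assignment V = V → Bool

litVal : {V : Set} → Assignment V → Lit V → Bool
litVal α (pos v) = α v
litVal α (neg v) = not (α v)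

SatClause : {V : Set} → Assignment V → Clause V → Set
SatClause α C = Any (λ l → T (litVal α l)) C

Sat : {V : Set} → Assignment V → CNF V → Set
Sat α φ = All (SatClause α) φ

Satisfiable : {V : Set} → CNF V → Set
Satisfiable {V} φ = ∃ λ (α : Assignment V) → Sat α φ

-- Restriction φ|τ by a partial assignment τ of the X-variables
-- (variables are X ⊎ Y, τ assigns X): delete clauses satisfied by τ,
-- delete literals falsified by τ.  The result is a CNF over Y.
data ClauseRes (Y : Set) : Set where
  satisfied : ClauseRes Y
  remaining : Clause Y → ClauseRes Y

restrictClause : {X Y : Set} → Assignment X → Clause (X ⊎ Y) → ClauseRes Y
restrictClause τ [] = remaining []
restrictClause τ (l ∷ C) with restrictClause τ C
... | satisfied = satisfied
... | remaining D with l
...   | pos (inj₁ x) = if τ x then satisfied else remaining D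
...   | neg (inj₁ x) = if τ x then remaining D else satisfied
...   | pos (inj₂ y) = remaining (pos y ∷ D)
...   | neg (inj₂ y) = remaining (neg y ∷ D)

restrict : {X Y : Set} → CNF (X ⊎ Y) → Assignment X → CNF Y
restrict [] τ = []
restrict (C ∷ φ) τ with restrictClause τ C
... | satisfied = restrict φ τ
... | remaining D = D ∷ restrict φ τ

countTrue : {n : ℕ} → (Fin n → Bool) → ℕ
countTrue {zero} τ = 0
countTrue {suc n} τ = (if τ zero then 1 else 0) + countTrue (τ ∘ suc)

AtMostK : (k n : ℕ) → (Fin n → Bool) → Set
AtMostK k n τ = countTrue τ ≤ k

EncodesAtMostK : (k n m : ℕ) → CNF (Fin n ⊎ Fin m) → Set
EncodesAtMostK k n m φ =
  (τ : Fin n → Bool) →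
    (AtMostK k n τ → Satisfiable (restrict φ τ)) × (Satisfiable (restrict φ τ) → AtMostK k n τ)

module Submission where

-- The inputs are placed on lines: the line (a , s) passes through the points
-- (t , a + s·t), t < k, and carries up to ℓ inputs at distinct offsets.  A true input
-- occupies its line and chooses one of the k points on it, recorded in the slot
-- (point , offset).  Sequential counters allow at most k chosen slots and, through each
-- used point, at most one occupied line.  Two distinct lines meet in at most one point,
-- so if at most k inputs are true, each of them has a point through which no other
-- occupied line passes, and choosing these points satisfies the formula.  Conversely,
-- distinct true inputs choose distinct slots, so at most k inputs are true.
-- Each input occurs in two clauses only.  With g = ⌈n^(1/(k+1))⌉, k·g slopes,
-- g offsets and about n / (k·g²) intercepts, all other clauses and all auxiliary
-- variables number O(k·n/g) = O(k·n^(k/(k+1))).  When g ≤ 8 the sequential counter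
-- on the inputs alone, with (2k+1)·n clauses and k·n variables, is small enough.

open import Defs
open import Data.Nat
  using (ℕ; zero; suc; _+_; _*_; _∸_; _^_; _/_; _%_; _≤_; _<_; z≤n; s≤s; z<s; _≤?_; _<?_; _<ᵇ_; NonZero; >-nonZero; >-nonZero⁻¹)
open import Data.Nat.Properties
  using ( ≤-refl; ≤-trans; ≤-reflexive; <-≤-trans; <⇒≤; <⇒≱; ≰⇒>; ≤-pred; <-cmp; n≤1+n; n<1+n
        ; m≤n⇒m<n∨m≡n; m≤n⇒∃[o]m+o≡n; m≤n+m; m≤m+n; m≤m*n; <ᵇ⇒<; <⇒<ᵇ
        ; +-comm; +-identityʳ; +-cancelˡ-≡; +-cancelʳ-≡; +-mono-≤; +-monoʳ-≤; +-monoˡ-≤; +-monoˡ-<; +-mono-<-≤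
        ; *-comm; *-assoc; *-identityʳ; *-cancelʳ-≡; *-cancelʳ-≤; *-mono-≤; *-monoˡ-≤; *-monoʳ-≤
        ; m+n∸n≡m; m∸n+n≡m; m+n∸m≡n; m∸n≤m; ∸-monoˡ-≤
        ; ^-distribˡ-+-*; ^-monoˡ-≤; ^-monoˡ-<; ^-monoʳ-≤; m^n>0; m^n≢0; ^-zeroˡ
        ; module ≤-Reasoning )
open import Data.Nat.DivMod using (m≡m%n+[m/n]*n; m%n<n; m/n*n≤m)
open import Data.Nat.Tactic.RingSolver using (solve-∀)
open import Data.Fin using (Fin; zero; suc; toℕ; fromℕ<; inject₁; inject≤; fromℕ)
open import Data.Fin.Properties
  using (suc-injective; toℕ-injective; toℕ<n; toℕ-fromℕ<; toℕ-inject₁; toℕ-fromℕ; inject≤-injective; 0≢1+n; any?; *↔×; +↔⊎; 1↔⊤)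
import Data.Fin.Properties as Fin
open import Data.Bool using (Bool; true; false; not; if_then_else_; T)
open import Data.Unit using (⊤; tt)
open import Data.Empty using (⊥-elim)
open import Data.Maybe using (Maybe; just; nothing; maybe)
open import Data.Product using (∃; _×_; _,_; proj₁; proj₂; map₁)
open import Data.Product.Properties using (≡-dec)
open import Data.Product.Function.NonDependent.Propositional using (_×-↔_)
open import Data.Sum using (_⊎_; inj₁; inj₂; [_,_]; [_,_]′; map₂)
import Data.Sum
open import Data.Sum.Function.Propositional using (_⊎-↔_)
open import Data.List using (List; []; _∷_; _++_; map; concat; tabulate)
open import Data.List.Properties using (length-map; length-++; length-tabulate)
open import Data.List.Relation.Unary.Any using (Any; here; there)
open import Data.List.Relation.Unary.All using (All; []; _∷_; head)
import Data.List.Relation.Unary.Any as Any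
import Data.List.Relation.Unary.All as All
import Data.List.Relation.Unary.Any.Properties as Any
import Data.List.Relation.Unary.All.Properties as All
open import Function using (_∘_; id; case_of_; _⇔_; mk⇔; _↔_; Inverse; Injection)
open import Function.Bundles using (Equivalence)
open import Function.Properties.Inverse using (↔-refl; ↔-sym; ↔-trans; ↔⇒↣)
open import Relation.Binary.PropositionalEquality using (_≡_; _≢_; refl; sym; trans; cong; cong₂; subst; subst₂; module ≡-Reasoning)
open import Relation.Binary.Definitions using (DecidableEquality; tri<; tri≈; tri>)
open import Relation.Nullary using (¬_; Dec; yes; no; ¬?; contradiction)
open import Relation.Nullary.Decidable using (⌊_⌋; _×-dec_; T?; toWitness; fromWitness; decidable-stable)

private variable
  V W X Y : Set
  a b c m : ℕ

mapLit : (V → W) → Lit V → Lit W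
mapLit f (pos v) = pos (f v)
mapLit f (neg v) = neg (f v)

renameClause : (V → W) → Clause V → Clause W
renameClause f = map (mapLit f)

rename : (V → W) → CNF V → CNF W
rename f = map (renameClause f)

size-rename : (f : V → W) (φ : CNF V) → size (rename f φ) ≡ size φ
size-rename f = length-map (renameClause f)

module _ {f : V → W} {β : Assignment W} {γ : Assignment V} (β∘f≗γ : ∀ v → β (f v) ≡ γ v) where

  litVal-mapLit : ∀ l → litVal β (mapLit f l) ≡ litVal γ l
  litVal-mapLit (pos v) = β∘f≗γ v
  litVal-mapLit (neg v) = cong not (β∘f≗γ v)

  SatClause-rename⁺ : (C : Clause V) → SatClause γ C → SatClause β (renameClause f C)
  SatClause-rename⁺ C = Any.map⁺ ∘ Any.map λ {l} → subst T (sym (litVal-mapLit l))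

  SatClause-rename⁻ : (C : Clause V) → SatClause β (renameClause f C) → SatClause γ C
  SatClause-rename⁻ C = Any.map (λ {l} → subst T (litVal-mapLit l)) ∘ Any.map⁻

  Sat-rename⁺ : (φ : CNF V) → Sat γ φ → Sat β (rename f φ)
  Sat-rename⁺ φ = All.map⁺ ∘ All.map (SatClause-rename⁺ _)

  Sat-rename⁻ : (φ : CNF V) → Sat β (rename f φ) → Sat γ φ
  Sat-rename⁻ φ = All.map (SatClause-rename⁻ _) ∘ All.map⁻

RestrictedClause : Assignment X → Clause (X ⊎ Y) → ClauseRes Y → Set
RestrictedClause τ C satisfied     = ∀ α → SatClause [ τ , α ] C
RestrictedClause τ C (remaining D) = ∀ α → SatClause α D ⇔ SatClause [ τ , α ] C

private
  Any-∷-cong : {A B : Set} {P : A → Set} {Q : B → Set} {x : A} {y : B} {xs : List A} {ys : List B} →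
    (P x → Q y) → (Q y → P x) → Any P xs ⇔ Any Q ys → Any P (x ∷ xs) ⇔ Any Q (y ∷ ys)
  Any-∷-cong f g xs⇔ys = mk⇔ (λ { (here p) → here (f p) ; (there p) → there (Equivalence.to xs⇔ys p) })
                             (λ { (here q) → here (g q) ; (there q) → there (Equivalence.from xs⇔ys q) })

  Any-∷-false : {A B : Set} {P : A → Set} {Q : B → Set} {y : B} {xs : List A} {ys : List B} →
    ¬ Q y → Any P xs ⇔ Any Q ys → Any P xs ⇔ Any Q (y ∷ ys)
  Any-∷-false ¬q xs⇔ys = mk⇔ (there ∘ Equivalence.to xs⇔ys)
                              (λ { (here q) → ⊥-elim (¬q q) ; (there q) → Equivalence.from xs⇔ys q })

restrictClause-correct : (τ : Assignment X) (C : Clause (X ⊎ Y)) → RestrictedClause τ C (restrictClause τ C)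
restrictClause-correct τ [] α = mk⇔ (λ ()) (λ ())
restrictClause-correct τ (l ∷ C) with restrictClause τ C | restrictClause-correct τ C
... | satisfied   | sat = there ∘ sat
... | remaining D | D⇔C with l
...   | pos (inj₂ y) = λ α → Any-∷-cong id id (D⇔C α)
...   | neg (inj₂ y) = λ α → Any-∷-cong id id (D⇔C α)
...   | pos (inj₁ x) with τ x in τx
...     | true  = λ α → here (subst T (sym τx) _)
...     | false = λ α → Any-∷-false (subst T τx) (D⇔C α)
restrictClause-correct τ (l ∷ C) | remaining D | D⇔C | neg (inj₁ x) with τ x in τx
...     | true  = λ α → Any-∷-false (subst (T ∘ not) τx) (D⇔C α)
...     | false = λ α → here (subst (T ∘ not) (sym τx) _)

Sat-restrict : (φ : CNF (X ⊎ Y)) (τ : Assignment X) (α : Assignment Y) → Sat α (restrict φ τ) ⇔ Sat [ τ , α ] φ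
Sat-restrict [] τ α = mk⇔ (λ _ → []) (λ _ → [])
Sat-restrict (C ∷ φ) τ α with restrictClause τ C | restrictClause-correct τ C
... | satisfied   | sat = mk⇔ (λ s → sat α ∷ Equivalence.to (Sat-restrict φ τ α) s)
                             (Equivalence.from (Sat-restrict φ τ α) ∘ All.tail)
... | remaining D | D⇔C = mk⇔ (λ { (d ∷ s) → Equivalence.to (D⇔C α) d ∷ Equivalence.to (Sat-restrict φ τ α) s })
                             (λ { (c ∷ s) → Equivalence.from (D⇔C α) c ∷ Equivalence.from (Sat-restrict φ τ α) s })

Encodes : (k : ℕ) {n : ℕ} {Y : Set} → CNF (Fin n ⊎ Y) → Set
Encodes k {n} φ = ∀ τ → AtMostK k n τ ⇔ ∃ λ β → Sat [ τ , β ] φ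

Encodes⇒EncodesAtMostK : ∀ {k n m} {φ : CNF (Fin n ⊎ Y)} (Y↔m : Y ↔ Fin m) → Encodes k φ →
  EncodesAtMostK k n m (rename (map₂ (Inverse.to Y↔m)) φ)
Encodes⇒EncodesAtMostK {k = k} {n} {m} {φ} Y↔m enc τ = sat , bounded
  where
  open Inverse Y↔m using (to; from; strictlyInverseʳ)
  φ′ : CNF (Fin n ⊎ Fin m)
  φ′ = rename (map₂ to) φ
  sat : AtMostK k n τ → Satisfiable (restrict φ′ τ)
  sat c with Equivalence.to (enc τ) c
  ... | β , s = β ∘ from , Equivalence.from (Sat-restrict _ τ (β ∘ from)) (Sat-rename⁺ pointwise φ s)
    where
    pointwise : ∀ v → [ τ , β ∘ from ] (map₂ to v) ≡ [ τ , β ] v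
    pointwise (inj₁ x) = refl
    pointwise (inj₂ y) = cong β (strictlyInverseʳ y)
  bounded : Satisfiable (restrict φ′ τ) → AtMostK k n τ
  bounded (α , s) = Equivalence.from (enc τ) (α ∘ to , Sat-rename⁻ pointwise φ (Equivalence.to (Sat-restrict _ τ α) s))
    where
    pointwise : ∀ v → [ τ , α ] (map₂ to v) ≡ [ τ , α ∘ to ] v
    pointwise (inj₁ x) = refl
    pointwise (inj₂ y) = refl

embed : {R : Set} → (R → V) → CNF (V ⊎ R) → CNF V
embed g = rename [ id , g ]′

Sat-embed : {R : Set} {β : Assignment V} (g : R → V) (φ : CNF (V ⊎ R)) → Sat β (embed g φ) ⇔ Sat [ β , β ∘ g ]′ φ
Sat-embed {β = β} g φ = mk⇔ (Sat-rename⁻ pointwise φ) (Sat-rename⁺ pointwise φ)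
  where
  pointwise : ∀ v → β ([ id , g ]′ v) ≡ [ β , β ∘ g ]′ v
  pointwise (inj₁ _) = refl
  pointwise (inj₂ _) = refl

infix 4 _⟹_ _⇒_

_⟹_ : List V → Clause V → Clause V
as ⟹ C = map neg as ++ C

_⇒_ : List V → V → Clause V
as ⇒ b = as ⟹ pos b ∷ []

module _ {β : Assignment V} where

  ⟹-intro : (as : List V) {C : Clause V} → (All (T ∘ β) as → SatClause β C) → SatClause β (as ⟹ C)
  ⟹-intro []       h = h []
  ⟹-intro (a ∷ as) h with β a in βa
  ... | false = here (subst (T ∘ not) (sym βa) _)
  ... | true  = there (⟹-intro as (h ∘ (subst T (sym βa) _ ∷_)))

  ⟹-elim : (as : List V) {C : Clause V} → SatClause β (as ⟹ C) → All (T ∘ β) as → SatClause β C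
  ⟹-elim []       s         []        = s
  ⟹-elim (a ∷ as) (here ¬a) (βa ∷ _) with β a
  ... | true  = ⊥-elim ¬a
  ... | false = ⊥-elim βa
  ⟹-elim (a ∷ as) (there s) (_ ∷ βas) = ⟹-elim as s βas

  ⇒-intro : (as : List V) {b : V} → (All (T ∘ β) as → T (β b)) → SatClause β (as ⇒ b)
  ⇒-intro as h = ⟹-intro as (here ∘ h)

  ⇒-elim : (as : List V) {b : V} → SatClause β (as ⇒ b) → All (T ∘ β) as → T (β b)
  ⇒-elim as s = Any.singleton⁻ ∘ ⟹-elim as s

⋀ : {n : ℕ} → (Fin n → CNF V) → CNF V
⋀ f = concat (tabulate f)

module _ {β : Assignment V} {n : ℕ} {f : Fin n → CNF V} where

  Sat-⋀⁺ : (∀ i → Sat β (f i)) → Sat β (⋀ f)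
  Sat-⋀⁺ = All.concat⁺ ∘ All.tabulate⁺

  Sat-⋀⁻ : Sat β (⋀ f) → ∀ i → Sat β (f i)
  Sat-⋀⁻ = All.tabulate⁻ ∘ All.concat⁻

size-⋀ : {n : ℕ} (f : Fin n → CNF V) {c : ℕ} → (∀ i → size (f i) ≤ c) → size (⋀ f) ≤ n * c
size-⋀ {n = zero}  f f≤c = z≤n
size-⋀ {n = suc n} f {c} f≤c = begin
  size (f zero ++ ⋀ (f ∘ suc))       ≡⟨ length-++ (f zero) ⟩
  size (f zero) + size (⋀ (f ∘ suc)) ≤⟨ +-mono-≤ (f≤c zero) (size-⋀ (f ∘ suc) (f≤c ∘ suc)) ⟩
  c + n * c                          ∎
  where open ≤-Reasoning

countTrue-const : (a : ℕ) → countTrue {a} (λ _ → true) ≡ a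
countTrue-const zero    = refl
countTrue-const (suc a) = cong suc (countTrue-const a)

remove : Fin b → (Fin b → Bool) → Fin b → Bool
remove zero     Q zero    = false
remove zero     Q (suc j) = Q (suc j)
remove (suc j₀) Q zero    = Q zero
remove (suc j₀) Q (suc j) = remove j₀ (Q ∘ suc) j

remove-≢ : (Q : Fin b → Bool) {j₀ j : Fin b} → j ≢ j₀ → T (Q j) → T (remove j₀ Q j)
remove-≢ Q {zero}   {zero}  j≢j₀ = ⊥-elim (j≢j₀ refl)
remove-≢ Q {zero}   {suc j} j≢j₀ = id
remove-≢ Q {suc j₀} {zero}  j≢j₀ = id
remove-≢ Q {suc j₀} {suc j} j≢j₀ = remove-≢ (Q ∘ suc) (j≢j₀ ∘ cong suc)

countTrue-remove : (Q : Fin b → Bool) (j₀ : Fin b) → T (Q j₀) → countTrue Q ≡ suc (countTrue (remove j₀ Q))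
countTrue-remove Q zero Qj₀ with Q zero
... | true = refl
countTrue-remove Q (suc j₀) Qj₀ with Q zero
... | true  = cong suc (countTrue-remove (Q ∘ suc) j₀ Qj₀)
... | false = countTrue-remove (Q ∘ suc) j₀ Qj₀

countTrue-mono-injective : (P : Fin a → Bool) (Q : Fin b → Bool) (f : ∀ i → T (P i) → Fin b) →
  (∀ i p → T (Q (f i p))) → (∀ i j p q → f i p ≡ f j q → i ≡ j) → countTrue P ≤ countTrue Q
countTrue-mono-injective {zero}  P Q f Qf f-inj = z≤n
-- Position 0 of P is matched with f 0, which is then switched off in Q.
countTrue-mono-injective {suc a} P Q f Qf f-inj with P zero in P₀
... | false = countTrue-mono-injective (P ∘ suc) Q (f ∘ suc) (Qf ∘ suc) (λ i j p q → suc-injective ∘ f-inj (suc i) (suc j) p q)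
... | true  = subst (suc (countTrue (P ∘ suc)) ≤_) (sym (countTrue-remove Q j₀ (Qf zero p₀)))
                (s≤s (countTrue-mono-injective (P ∘ suc) (remove j₀ Q) (f ∘ suc) Qf′
                                               (λ i j p q → suc-injective ∘ f-inj (suc i) (suc j) p q)))
  where
  p₀ : T (P zero)
  p₀ = subst T (sym P₀) _
  j₀ : Fin _
  j₀ = f zero p₀
  Qf′ : ∀ i p → T (remove j₀ Q (f (suc i) p))
  Qf′ i p = remove-≢ Q (λ e → 0≢1+n (f-inj zero (suc i) p₀ p (sym e))) (Qf (suc i) p)

countTrue-≤ : (P : Fin a → Bool) (f : ∀ i → T (P i) → Fin m) → (∀ i j p q → f i p ≡ f j q → i ≡ j) → countTrue P ≤ m
countTrue-≤ {m = m} P f f-inj =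
  subst (countTrue P ≤_) (countTrue-const m) (countTrue-mono-injective P (λ _ → true) f (λ _ _ → _) f-inj)

≤-countTrue : (Q : Fin b → Bool) (f : Fin m → Fin b) → (∀ i → T (Q (f i))) → (∀ i j → f i ≡ f j → i ≡ j) →
  m ≤ countTrue Q
≤-countTrue {m = m} Q f Qf f-inj = subst (_≤ countTrue Q) (countTrue-const m)
  (countTrue-mono-injective (λ _ → true) Q (λ i _ → f i) (λ i _ → Qf i) (λ i j _ _ → f-inj i j))

countTrue≤1 : (Q : Fin b → Bool) (j₀ : Fin b) → (∀ j → T (Q j) → j ≡ j₀) → countTrue Q ≤ 1
countTrue≤1 Q j₀ unique = countTrue-≤ Q (λ _ _ → zero) (λ i j p q _ → trans (unique i p) (sym (unique j q)))

2≤countTrue : (Q : Fin b → Bool) {i j : Fin b} → i ≢ j → T (Q i) → T (Q j) → 2 ≤ countTrue Q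
2≤countTrue Q {i} {j} i≢j Qi Qj = ≤-countTrue Q f Qf f-inj
  where
  f : Fin 2 → Fin _
  f zero = i
  f (suc zero) = j
  Qf : ∀ x → T (Q (f x))
  Qf zero = Qi
  Qf (suc zero) = Qj
  f-inj : ∀ x y → f x ≡ f y → x ≡ y
  f-inj zero       zero       _ = refl
  f-inj zero       (suc zero) e = ⊥-elim (i≢j e)
  f-inj (suc zero) zero       e = ⊥-elim (i≢j (sym e))
  f-inj (suc zero) (suc zero) _ = refl

countTrue-head : (Q : Fin (suc b) → Bool) → T (Q zero) → countTrue Q ≡ suc (countTrue (Q ∘ suc))
countTrue-head Q Q₀ with Q zero
... | true = refl

countTrue-tail≤ : (Q : Fin (suc b) → Bool) → countTrue (Q ∘ suc) ≤ countTrue Q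
countTrue-tail≤ Q = m≤n+m _ (if Q zero then 1 else 0)

module _ {B : Set} (_≟ᴮ_ : DecidableEquality B) where

  opaque
    image : (Fin a → Bool) → (Fin a → B) → B → Bool
    image τ f b = ⌊ any? (λ i → T? (τ i) ×-dec (f i ≟ᴮ b)) ⌋

    image-intro : ∀ {τ : Fin a → Bool} {f} i → T (τ i) → T (image τ f (f i))
    image-intro i τi = fromWitness (i , τi , refl)

    image-elim : ∀ {τ : Fin a → Bool} {f b} → T (image τ f b) → ∃ λ i → T (τ i) × f i ≡ b
    image-elim = toWitness

  countTrue-image : (τ : Fin a → Bool) (f : Fin a → B) (g : Fin m → B) → (∀ r r′ → g r ≡ g r′ → r ≡ r′) →
    countTrue (image τ f ∘ g) ≤ countTrue τ
  countTrue-image τ f g g-inj =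
    countTrue-mono-injective (image τ f ∘ g) τ (λ r → proj₁ ∘ image-elim) (λ r → proj₁ ∘ proj₂ ∘ image-elim)
      (λ r r′ p p′ e → g-inj r r′ (trans (sym (proj₂ (proj₂ (image-elim p)))) (trans (cong f e) (proj₂ (proj₂ (image-elim p′))))))

-- Sinz's sequential counter: register (i , j) records that at least j + 1 of
-- ys i, ys (i + 1), … are true, and G is forced once more than K of them are.
module SequentialCounter (K′ : ℕ) where

  K : ℕ
  K = suc K′

  Register : ℕ → Set
  Register N = Fin N × Fin K

  shift : {N : ℕ} → V ⊎ Register N → V ⊎ Register (suc N)
  shift = map₂ (map₁ suc)

  module _ {N : ℕ} {V : Set} where

    r₀ r₁ : Fin K → V ⊎ Register (suc (suc N))
    r₀ j = inj₂ (zero , j)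
    r₁ j = inj₂ (suc zero , j)

    carry-clause : Fin K → Clause (V ⊎ Register (suc (suc N)))
    carry-clause j = r₁ j ∷ [] ⇒ r₀ j

    increment-clause : V → Fin K′ → Clause (V ⊎ Register (suc (suc N)))
    increment-clause y j = inj₁ y ∷ r₁ (inject₁ j) ∷ [] ⇒ r₀ (suc j)

    carries : CNF (V ⊎ Register (suc (suc N)))
    carries = tabulate carry-clause

    increments : V → CNF (V ⊎ Register (suc (suc N)))
    increments y = tabulate (increment-clause y)

    overflows : V → Clause V → Clause (V ⊎ Register (suc (suc N)))
    overflows y G = inj₁ y ∷ r₁ (fromℕ K′) ∷ [] ⟹ renameClause inj₁ G

    step : V → Clause V → CNF (V ⊎ Register (suc (suc N)))
    step y G = (inj₁ y ∷ [] ⇒ r₀ zero) ∷ carries ++ increments y ++ overflows y G ∷ []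

    record StepHolds (β : Assignment (V ⊎ Register (suc (suc N)))) (y : V) (G : Clause V) : Set where
      field
        start     : T (β (inj₁ y)) → T (β (r₀ zero))
        carry     : ∀ j → T (β (r₁ j)) → T (β (r₀ j))
        increment : ∀ j → T (β (inj₁ y)) → T (β (r₁ (inject₁ j))) → T (β (r₀ (suc j)))
        overflow  : T (β (inj₁ y)) → T (β (r₁ (fromℕ K′))) → SatClause (β ∘ inj₁) G

    Sat-step : {β : Assignment (V ⊎ Register (suc (suc N)))} {y : V} {G : Clause V} →
               Sat β (step y G) ⇔ StepHolds β y G
    Sat-step {β} {y} {G} = mk⇔ holds sat
      where
      holds : Sat β (step y G) → StepHolds β y G
      holds (s₀ ∷ s) = record
        { start     = λ βy → ⇒-elim (inj₁ y ∷ []) s₀ (βy ∷ [])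
        ; carry     = λ j r → ⇒-elim (r₁ j ∷ []) (All.tabulate⁻ {f = carry-clause} (All.++⁻ˡ carries s) j) (r ∷ [])
        ; increment = λ j βy r → ⇒-elim (inj₁ y ∷ r₁ (inject₁ j) ∷ [])
                                   (All.tabulate⁻ {f = increment-clause y} (All.++⁻ˡ (increments y) s′) j) (βy ∷ r ∷ [])
        ; overflow  = λ βy r → SatClause-rename⁻ (λ _ → refl) G
                                 (⟹-elim (inj₁ y ∷ r₁ (fromℕ K′) ∷ []) (head (All.++⁻ʳ (increments y) s′)) (βy ∷ r ∷ []))
        }
        where
        s′ : Sat β (increments y ++ overflows y G ∷ [])
        s′ = All.++⁻ʳ carries s
      sat : StepHolds β y G → Sat β (step y G)
      sat h = ⇒-intro (inj₁ y ∷ []) (λ { (βy ∷ []) → start βy })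
            ∷ All.++⁺ (All.tabulate⁺ {f = carry-clause} λ j → ⇒-intro (r₁ j ∷ []) λ { (r ∷ []) → carry j r })
              (All.++⁺ (All.tabulate⁺ {f = increment-clause y} λ j →
                          ⇒-intro (inj₁ y ∷ r₁ (inject₁ j) ∷ []) λ { (βy ∷ r ∷ []) → increment j βy r })
                (⟹-intro (inj₁ y ∷ r₁ (fromℕ K′) ∷ [])
                   (λ { (βy ∷ r ∷ []) → SatClause-rename⁺ (λ _ → refl) G (overflow βy r) }) ∷ []))
        where open StepHolds h

  counter : (N : ℕ) → (Fin N → V) → Clause V → CNF (V ⊎ Register N)
  counter zero          ys G = []
  counter (suc zero)    ys G = (inj₁ (ys zero) ∷ [] ⇒ inj₂ (zero , zero)) ∷ []
  counter (suc (suc N)) ys G = step (ys zero) G ++ rename shift (counter (suc N) (ys ∘ suc) G)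

  module _ {N : ℕ} {V : Set} {ys : Fin (suc (suc N)) → V} {G : Clause V} {β : Assignment (V ⊎ Register (suc (suc N)))}
           (s : Sat β (counter (suc (suc N)) ys G)) where

    head-holds : StepHolds β (ys zero) G
    head-holds = Equivalence.to Sat-step (All.++⁻ˡ (step (ys zero) G) s)

    tail-sat : Sat (β ∘ shift) (counter (suc N) (ys ∘ suc) G)
    tail-sat = Sat-rename⁻ (λ _ → refl) _ (All.++⁻ʳ (step (ys zero) G) s)

  counter-registers : {V : Set} (N : ℕ) {ys : Fin (suc N) → V} {G : Clause V} {β : Assignment (V ⊎ Register (suc N))} →
    Sat β (counter (suc N) ys G) → ∀ j → toℕ j < countTrue (β ∘ inj₁ ∘ ys) → T (β (inj₂ (zero , j)))
  counter-registers zero {ys} {β = β} (c ∷ []) j j<c with β (inj₁ (ys zero)) in βy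
  counter-registers zero {ys} {β = β} (c ∷ []) zero    j<c       | true = ⇒-elim (inj₁ (ys zero) ∷ []) c (subst T (sym βy) _ ∷ [])
  counter-registers zero {ys} {β = β} (c ∷ []) (suc j) (s≤s ())  | true
  counter-registers zero {ys} {β = β} (c ∷ []) j       ()        | false
  counter-registers (suc N) {ys} {β = β} s j j<c with β (inj₁ (ys zero)) in βy
  ... | false = carry j (counter-registers N (tail-sat {ys = ys} s) j j<c)
    where open StepHolds (head-holds {ys = ys} s)
  counter-registers (suc N) {ys} {β = β} s zero    j<c       | true = start (subst T (sym βy) _)
    where open StepHolds (head-holds {ys = ys} s)
  counter-registers (suc N) {ys} {β = β} s (suc j) (s≤s j<c) | true =
    increment j (subst T (sym βy) _) (counter-registers N (tail-sat {ys = ys} s) (inject₁ j) (subst (_< _) (sym (toℕ-inject₁ j)) j<c))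
    where open StepHolds (head-holds {ys = ys} s)

  counter-bounded : {V : Set} (N : ℕ) {ys : Fin N → V} {G : Clause V} {β : Assignment (V ⊎ Register N)} →
    Sat β (counter N ys G) → countTrue (β ∘ inj₁ ∘ ys) ≤ K ⊎ SatClause (β ∘ inj₁) G
  counter-bounded zero s = inj₁ z≤n
  counter-bounded (suc zero) {ys} {β = β} s with β (inj₁ (ys zero))
  ... | true  = inj₁ (s≤s z≤n)
  ... | false = inj₁ z≤n
  counter-bounded (suc (suc N)) {ys} {β = β} s with counter-bounded (suc N) (tail-sat {ys = ys} s)
  ... | inj₂ g = inj₂ g
  ... | inj₁ c′≤K with β (inj₁ (ys zero)) in βy
  ...   | false = inj₁ c′≤K
  ...   | true with m≤n⇒m<n∨m≡n c′≤K
  ...     | inj₁ c′<K = inj₁ c′<K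
  ...     | inj₂ c′≡K = inj₂ (overflow (subst T (sym βy) _) (counter-registers N (tail-sat {ys = ys} s) (fromℕ K′) K′<c′))
    where
    open StepHolds (head-holds {ys = ys} s)
    K′<c′ : toℕ (fromℕ K′) < countTrue (β ∘ inj₁ ∘ ys ∘ suc)
    K′<c′ = subst₂ _<_ (sym (toℕ-fromℕ K′)) (sym c′≡K) (n<1+n K′)

  suffixCount : {N : ℕ} → (Fin N → Bool) → Fin N → ℕ
  suffixCount bs zero    = countTrue bs
  suffixCount bs (suc i) = suffixCount (bs ∘ suc) i

  registers : {N : ℕ} → (Fin N → Bool) → Register N → Bool
  registers bs (i , j) = toℕ j <ᵇ suffixCount bs i

  module RegisterValues {N : ℕ} {V : Set} (β : Assignment (V ⊎ Register N)) {bs : Fin N → Bool}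
                        (β≗registers : ∀ r → β (inj₂ r) ≡ registers bs r) where

    register⁺ : ∀ i j → toℕ j < suffixCount bs i → T (β (inj₂ (i , j)))
    register⁺ i j lt = subst T (sym (β≗registers (i , j))) (<⇒<ᵇ lt)

    register⁻ : ∀ i j → T (β (inj₂ (i , j))) → toℕ j < suffixCount bs i
    register⁻ i j r = <ᵇ⇒< (toℕ j) _ (subst T (β≗registers (i , j)) r)

  counter-satisfied : {V : Set} (N : ℕ) {ys : Fin N → V} {G : Clause V} {β : Assignment (V ⊎ Register N)} (bs : Fin N → Bool) →
    (∀ i → β (inj₁ (ys i)) ≡ bs i) → (∀ r → β (inj₂ r) ≡ registers bs r) →
    countTrue bs ≤ K ⊎ SatClause (β ∘ inj₁) G → Sat β (counter N ys G)
  counter-satisfied zero bs β≗bs β≗registers bound = []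
  counter-satisfied (suc zero) {ys} {β = β} bs β≗bs β≗registers bound =
    ⇒-intro (inj₁ (ys zero) ∷ []) (λ { (βy ∷ []) → register⁺ zero zero (count>0 βy) }) ∷ []
    where
    open RegisterValues β β≗registers
    count>0 : T (β (inj₁ (ys zero))) → 0 < countTrue bs
    count>0 βy = subst (0 <_) (sym (countTrue-head bs (subst T (β≗bs zero) βy))) z<s
  counter-satisfied (suc (suc N)) {ys} {G} {β} bs β≗bs β≗registers bound =
    All.++⁺ (Equivalence.from Sat-step holds)
            (Sat-rename⁺ (λ _ → refl) _ (counter-satisfied (suc N) (bs ∘ suc) (β≗bs ∘ suc) (β≗registers ∘ map₁ suc) bound′))
    where
    b₀ : T (β (inj₁ (ys zero))) → T (bs zero)
    b₀ = subst T (β≗bs zero)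
    c≡1+c′ : T (β (inj₁ (ys zero))) → countTrue bs ≡ suc (countTrue (bs ∘ suc))
    c≡1+c′ = countTrue-head bs ∘ b₀
    bound′ : countTrue (bs ∘ suc) ≤ K ⊎ SatClause (β ∘ inj₁) G
    bound′ = Data.Sum.map₁ (≤-trans (countTrue-tail≤ bs)) bound
    holds : StepHolds β (ys zero) G
    holds = record
      { start     = λ βy → register⁺ zero zero (subst (0 <_) (sym (c≡1+c′ βy)) z<s)
      ; carry     = λ j r → register⁺ zero j (<-≤-trans (register⁻ (suc zero) j r) (countTrue-tail≤ bs))
      ; increment = λ j βy r → register⁺ zero (suc j) (subst (suc (toℕ j) <_) (sym (c≡1+c′ βy))
                                 (s≤s (subst (_< _) (toℕ-inject₁ j) (register⁻ (suc zero) (inject₁ j) r))))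
      ; overflow  = λ βy r → overflow βy (register⁻ (suc zero) (fromℕ K′) r)
      }
      where
      open RegisterValues β β≗registers
      overflow : T (β (inj₁ (ys zero))) → toℕ (fromℕ K′) < countTrue (bs ∘ suc) → SatClause (β ∘ inj₁) G
      overflow βy K′<c′ = [ (λ c≤K → contradiction (subst (_≤ K) (c≡1+c′ βy) c≤K) (<⇒≱ (s≤s K≤c′))) , id ]′ bound
        where
        K≤c′ : K′ < countTrue (bs ∘ suc)
        K≤c′ = subst (_< _) (toℕ-fromℕ K′) K′<c′

  size-step : {N : ℕ} {V : Set} (y : V) (G : Clause V) → size (step {N} y G) ≡ 2 * K + 1
  size-step y G = begin
    suc (size (carries ++ increments y ++ overflows y G ∷ []))     ≡⟨ cong suc (length-++ carries) ⟩
    suc (size carries + size (increments y ++ overflows y G ∷ [])) ≡⟨ cong (λ l → suc (size carries + l)) (length-++ (increments y)) ⟩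
    suc (size carries + (size (increments y) + 1))               ≡⟨ cong₂ (λ a b → suc (a + (b + 1)))
                                                                          (length-tabulate carry-clause) (length-tabulate (increment-clause y)) ⟩
    suc (K + (K′ + 1))                                           ≡⟨ arithmetic K′ ⟩
    2 * K + 1                                                    ∎
    where
    open ≡-Reasoning
    arithmetic : ∀ k → suc (suc k + (k + 1)) ≡ 2 * suc k + 1
    arithmetic = solve-∀

  size-counter : {V : Set} (N : ℕ) (ys : Fin N → V) (G : Clause V) → size (counter N ys G) ≤ N * (2 * K + 1)
  size-counter zero          ys G = z≤n
  size-counter (suc zero)    ys G = s≤s z≤n
  size-counter (suc (suc N)) ys G = begin
    size (step (ys zero) G ++ rename shift tail)       ≡⟨ length-++ (step (ys zero) G) ⟩
    size (step (ys zero) G) + size (rename shift tail) ≡⟨ cong₂ _+_ (size-step (ys zero) G) (size-rename shift tail) ⟩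
    (2 * K + 1) + size tail                          ≤⟨ +-monoʳ-≤ (2 * K + 1) (size-counter (suc N) (ys ∘ suc) G) ⟩
    (2 * K + 1) + suc N * (2 * K + 1)                ∎
    where
    open ≤-Reasoning
    tail : CNF (_ ⊎ Register (suc N))
    tail = counter (suc N) (ys ∘ suc) G

affine-slope : ∀ {a a′ s s′ t t′} → t < t′ → a + s * t ≡ a′ + s′ * t → a + s * t′ ≡ a′ + s′ * t′ → s ≡ s′
affine-slope {a} {a′} {s} {s′} {t} t<t′ e e′ with m≤n⇒∃[o]m+o≡n t<t′
... | d , refl = *-cancelʳ-≡ s s′ (suc d) (+-cancelˡ-≡ (a + s * t) (s * suc d) (s′ * suc d) (begin
  a + s * t + s * suc d       ≡⟨ split a s t d ⟩
  a + s * (suc t + d)         ≡⟨ e′ ⟩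
  a′ + s′ * (suc t + d)       ≡⟨ split a′ s′ t d ⟨
  a′ + s′ * t + s′ * suc d    ≡⟨ cong (_+ s′ * suc d) e ⟨
  a + s * t + s′ * suc d      ∎))
  where
  open ≡-Reasoning
  split : ∀ a s t d → a + s * t + s * suc d ≡ a + s * (suc t + d)
  split = solve-∀

module Lines (k′ A S : ℕ) where

  k P : ℕ
  k = suc k′
  P = A + S * k′

  Line Point : Set
  Line  = Fin A × Fin S
  Point = Fin k × Fin P

  slope : Line → Fin S
  slope = proj₂

  height : Fin k → Line → Fin P
  height t (a , s) = fromℕ< (+-mono-<-≤ (toℕ<n a) (*-mono-≤ (<⇒≤ (toℕ<n s)) (≤-pred (toℕ<n t))))

  toℕ-height : ∀ t a s → toℕ (height t (a , s)) ≡ toℕ a + toℕ s * toℕ t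
  toℕ-height t a s = toℕ-fromℕ< _

  height-cong : ∀ t a s a′ s′ → height t (a , s) ≡ height t (a′ , s′) →
                toℕ a + toℕ s * toℕ t ≡ toℕ a′ + toℕ s′ * toℕ t
  height-cong t a s a′ s′ e = trans (sym (toℕ-height t a s)) (trans (cong toℕ e) (toℕ-height t a′ s′))

  parallel-lines : ∀ t {L L′} → slope L ≡ slope L′ → height t L ≡ height t L′ → L ≡ L′
  parallel-lines t {a , s} {a′ , .s} refl e = cong (_, s) (toℕ-injective (+-cancelʳ-≡ _ _ _ (height-cong t a s a′ s e)))

  lines-meet-once : ∀ {t t′ L L′} → t ≢ t′ → height t L ≡ height t L′ → height t′ L ≡ height t′ L′ → L ≡ L′
  lines-meet-once {t} {t′} {a , s} {a′ , s′} t≢t′ e e′ = parallel-lines t (toℕ-injective same-slope) e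
    where
    same-slope : toℕ s ≡ toℕ s′
    same-slope with <-cmp (toℕ t) (toℕ t′)
    ... | tri< t<t′ _ _ = affine-slope t<t′ (height-cong t a s a′ s′ e) (height-cong t′ a s a′ s′ e′)
    ... | tri≈ _ t≡t′ _ = ⊥-elim (t≢t′ (toℕ-injective t≡t′))
    ... | tri> _ _ t′<t = affine-slope t′<t (height-cong t′ a s a′ s′ e′) (height-cong t a s a′ s′ e)

  height∸slope : ∀ t a s → toℕ (height t (a , s)) ∸ toℕ s * toℕ t ≡ toℕ a
  height∸slope t a s = trans (cong (_∸ toℕ s * toℕ t) (toℕ-height t a s)) (m+n∸n≡m (toℕ a) (toℕ s * toℕ t))

  opaque
    lineThrough : Point → Fin S → Maybe Line
    lineThrough (t , v) s with toℕ s * toℕ t ≤? toℕ v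
    ... | no _ = nothing
    ... | yes _ with toℕ v ∸ toℕ s * toℕ t <? A
    ...   | no _    = nothing
    ...   | yes a<A = just (fromℕ< a<A , s)

    lineThrough-height : ∀ t L → lineThrough (t , height t L) (slope L) ≡ just L
    lineThrough-height t (a , s) with toℕ s * toℕ t ≤? toℕ (height t (a , s))
    ... | no st≰v = ⊥-elim (st≰v (subst (toℕ s * toℕ t ≤_) (sym (toℕ-height t a s)) (m≤n+m _ _)))
    ... | yes _ with toℕ (height t (a , s)) ∸ toℕ s * toℕ t <? A
    ...   | no a≮A  = ⊥-elim (a≮A (subst (_< A) (sym (height∸slope t a s)) (toℕ<n a)))
    ...   | yes a<A = cong (λ a → just (a , s)) (toℕ-injective (trans (toℕ-fromℕ< a<A) (height∸slope t a s)))

    lineThrough-just : ∀ t v s {L} → lineThrough (t , v) s ≡ just L → slope L ≡ s × height t L ≡ v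
    lineThrough-just t v s e with toℕ s * toℕ t ≤? toℕ v
    ... | yes st≤v with toℕ v ∸ toℕ s * toℕ t <? A
    lineThrough-just t v s refl | yes st≤v | yes a<A =
      refl , toℕ-injective (trans (toℕ-height t _ s) (trans (cong (_+ toℕ s * toℕ t) (toℕ-fromℕ< a<A)) (m∸n+n≡m st≤v)))


_⊕_ : X ↔ Fin a → Y ↔ Fin b → (X ⊎ Y) ↔ Fin (a + b)
e ⊕ f = ↔-trans (e ⊎-↔ f) (↔-sym +↔⊎)

_⊗_ : X ↔ Fin a → Y ↔ Fin b → (X × Y) ↔ Fin (a * b)
e ⊗ f = ↔-trans (e ×-↔ f) (↔-sym *↔×)

infixr 5 _⊕_
infixr 6 _⊗_

cells↔ : Fin (a * b * c) ↔ ((Fin a × Fin b) × Fin c)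
cells↔ = ↔-trans *↔× (*↔× ×-↔ ↔-refl)

∀-↔ : {P : Y → Set} (e : X ↔ Y) → (∀ x → P (Inverse.to e x)) → ∀ y → P y
∀-↔ {P = P} e h y = subst P (Inverse.strictlyInverseˡ e y) (h (Inverse.from e y))

module GridEncoding (n k′ A S ℓ : ℕ) (n≤ASℓ : n ≤ A * S * ℓ) where

  open Lines k′ A S public

  Slot : Set
  Slot = Point × Fin ℓ

  slotCount : ℕ
  slotCount = k * P * ℓ

  slot : Fin slotCount → Slot
  slot = Inverse.to cells↔

  point : Fin (k * P) → Point
  point = Inverse.to *↔×

  place : Fin n → Line × Fin ℓ
  place i = Inverse.to cells↔ (inject≤ i n≤ASℓ)

  place-injective : ∀ i j → place i ≡ place j → i ≡ j
  place-injective i j = inject≤-injective n≤ASℓ n≤ASℓ i j ∘ Injection.injective (↔⇒↣ cells↔)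

  line : Fin n → Line
  line = proj₁ ∘ place

  offset : Fin n → Fin ℓ
  offset = proj₂ ∘ place

  module SlotCounter = SequentialCounter k′
  module LineCounter = SequentialCounter 0

  Aux : Set
  Aux = Line ⊎ Slot ⊎ Point ⊎ ⊤ ⊎ SlotCounter.Register slotCount ⊎ Point × LineCounter.Register S

  auxCount : ℕ
  auxCount = A * S + (slotCount + (k * P + (1 + (slotCount * k + k * P * (S * 1)))))

  aux↔ : Aux ↔ Fin auxCount
  aux↔ = ↔-refl ⊗ ↔-refl ⊕ (↔-refl ⊗ ↔-refl) ⊗ ↔-refl ⊕ ↔-refl ⊗ ↔-refl ⊕ ↔-sym 1↔⊤
       ⊕ ↔-refl ⊗ ↔-refl ⊕ (↔-refl ⊗ ↔-refl) ⊗ (↔-refl ⊗ ↔-refl)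

  Var : Set
  Var = Fin n ⊎ Aux

  -- occupied L: some true input lies on L;  chosen (p , c): the true input at offset c
  -- of a line through p chose p;  used p: some slot at p is chosen;  dummy: false,
  -- standing for the missing line of a given slope through a point.
  pattern input i          = inj₁ i
  pattern occupied L       = inj₂ (inj₁ L)
  pattern chosen σ         = inj₂ (inj₂ (inj₁ σ))
  pattern used p           = inj₂ (inj₂ (inj₂ (inj₁ p)))
  pattern dummy            = inj₂ (inj₂ (inj₂ (inj₂ (inj₁ tt))))
  pattern slotRegister r   = inj₂ (inj₂ (inj₂ (inj₂ (inj₂ (inj₁ r)))))
  pattern lineRegister p r = inj₂ (inj₂ (inj₂ (inj₂ (inj₂ (inj₂ (p , r))))))

  slotOf : Fin k → Fin n → Slot
  slotOf t i = (t , height t (line i)) , offset i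

  lineVar : Point → Fin S → Var
  lineVar p s = maybe (λ L → occupied L) dummy (lineThrough p s)

  inputClauses : Fin n → CNF Var
  inputClauses i = (input i ∷ [] ⇒ occupied (line i))
                 ∷ (input i ∷ [] ⟹ tabulate (λ t → pos (chosen (slotOf t i))))
                 ∷ []

  slotCounter : CNF Var
  slotCounter = embed (λ r → slotRegister r) (SlotCounter.counter slotCount (λ r → chosen (slot r)) [])

  usedClauses : CNF Var
  usedClauses = tabulate λ r → chosen (slot r) ∷ [] ⇒ used (proj₁ (slot r))

  lineCounter : Point → CNF Var
  lineCounter p = embed (λ r → lineRegister p r) (LineCounter.counter S (lineVar p) (neg (used p) ∷ []))

  formula : CNF Var
  formula = ⋀ inputClauses ++ slotCounter ++ usedClauses ++ ⋀ (lineCounter ∘ point)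

  size-formula : size formula ≤ 2 * n + (slotCount * (2 * k + 1) + (slotCount + k * P * (S * 3)))
  size-formula = begin
    size formula
      ≡⟨ trans (length-++ (⋀ inputClauses))
               (cong (size (⋀ inputClauses) +_) (trans (length-++ slotCounter) (cong (size slotCounter +_) (length-++ usedClauses)))) ⟩
    size (⋀ inputClauses) + (size slotCounter + (size usedClauses + size (⋀ (lineCounter ∘ point))))
      ≤⟨ +-mono-≤ (size-⋀ inputClauses (λ _ → ≤-refl))
           (+-mono-≤ size-slotCounter (+-mono-≤ (≤-reflexive (length-tabulate _)) (size-⋀ (lineCounter ∘ point) size-lineCounter))) ⟩
    n * 2 + (slotCount * (2 * k + 1) + (slotCount + k * P * (S * 3)))
      ≡⟨ cong (_+ (slotCount * (2 * k + 1) + (slotCount + k * P * (S * 3)))) (*-comm n 2) ⟩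
    2 * n + (slotCount * (2 * k + 1) + (slotCount + k * P * (S * 3))) ∎
    where
    open ≤-Reasoning
    size-slotCounter : size slotCounter ≤ slotCount * (2 * k + 1)
    size-slotCounter = ≤-trans (≤-reflexive (size-rename _ (SlotCounter.counter slotCount (λ r → chosen (slot r)) [])))
                               (SlotCounter.size-counter slotCount _ [])
    size-lineCounter : ∀ q → size (lineCounter (point q)) ≤ S * 3
    size-lineCounter q = ≤-trans (≤-reflexive (size-rename _ (LineCounter.counter S (lineVar (point q)) (neg (used (point q)) ∷ []))))
                                 (LineCounter.size-counter S _ _)

  _≟ᴸ_ : DecidableEquality Line
  _≟ᴸ_ = ≡-dec Fin._≟_ Fin._≟_

  _≟ᴾ_ : DecidableEquality Point
  _≟ᴾ_ = ≡-dec Fin._≟_ Fin._≟_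

  _≟ˢ_ : DecidableEquality Slot
  _≟ˢ_ = ≡-dec _≟ᴾ_ Fin._≟_

  module Satisfying (τ : Fin n → Bool) (few : countTrue τ ≤ k) where

    Blocked : Fin n → Fin k → Set
    Blocked i t = ∃ λ j → T (τ j) × line j ≢ line i × height t (line j) ≡ height t (line i)

    blocked? : ∀ i t → Dec (Blocked i t)
    blocked? i t = any? λ j → T? (τ j) ×-dec ¬? (line j ≟ᴸ line i) ×-dec (height t (line j) Fin.≟ height t (line i))

    opaque
      choice : Fin n → Fin k
      choice i with any? (λ t → ¬? (blocked? i t))
      ... | yes (t , _) = t
      ... | no _        = zero

      choice-unblocked : ∀ i → T (τ i) → ¬ Blocked i (choice i)
      choice-unblocked i τi with any? (λ t → ¬? (blocked? i t))
      ... | yes (t , unblocked) = unblocked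
      ... | no none = ⊥-elim (<⇒≱ (s≤s ≤-refl) (≤-trans (≤-countTrue τ blockers τ-blockers blockers-injective) few))
        where
        blocking : ∀ t → Blocked i t
        blocking t = decidable-stable (blocked? i t) (λ unblocked → none (t , unblocked))
        blockers : Fin (suc k) → Fin n
        blockers zero    = i
        blockers (suc t) = proj₁ (blocking t)
        τ-blockers : ∀ u → T (τ (blockers u))
        τ-blockers zero    = τi
        τ-blockers (suc t) = proj₁ (proj₂ (blocking t))
        off-line : ∀ t → line (blockers (suc t)) ≢ line i
        off-line t = proj₁ (proj₂ (proj₂ (blocking t)))
        meets : ∀ t → height t (line (blockers (suc t))) ≡ height t (line i)
        meets t = proj₂ (proj₂ (proj₂ (blocking t)))
        blockers-injective : ∀ u u′ → blockers u ≡ blockers u′ → u ≡ u′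
        blockers-injective zero    zero     e = refl
        blockers-injective zero    (suc t)  e = ⊥-elim (off-line t (cong line (sym e)))
        blockers-injective (suc t) zero     e = ⊥-elim (off-line t (cong line e))
        blockers-injective (suc t) (suc t′) e with t Fin.≟ t′
        ... | yes t≡t′ = cong suc t≡t′
        ... | no  t≢t′ = ⊥-elim (off-line t (lines-meet-once t≢t′ (meets t) (trans (cong (height t′ ∘ line) e) (meets t′))))

    chosenSlot : Fin n → Slot
    chosenSlot i = slotOf (choice i) i

    isOccupied : Line → Bool
    isOccupied = image _≟ᴸ_ τ line

    isChosen : Slot → Bool
    isChosen = image _≟ˢ_ τ chosenSlot

    isUsed : Point → Bool
    isUsed = image _≟ᴾ_ τ (proj₁ ∘ chosenSlot)

    -- The values of all variables but the registers, which are computed from them.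
    base : Var → Bool
    base = [ τ , [ isOccupied , [ isChosen , [ isUsed , (λ _ → false) ]′ ]′ ]′ ]′

    assignment : Aux → Bool
    assignment = [ isOccupied , [ isChosen , [ isUsed , [ (λ _ → false) , [ SlotCounter.registers (isChosen ∘ slot)
                 , (λ (p , r) → LineCounter.registers (base ∘ lineVar p) r) ]′ ]′ ]′ ]′ ]′

    α : Var → Bool
    α = [ τ , assignment ]′

    lineVar-base : ∀ p s → α (lineVar p s) ≡ base (lineVar p s)
    lineVar-base p s = unregistered (lineThrough p s)
      where
      unregistered : (m : Maybe Line) → α (maybe (λ L → occupied L) dummy m) ≡ base (maybe (λ L → occupied L) dummy m)
      unregistered (just _) = refl
      unregistered nothing  = refl

    used-if-chosen : ∀ σ → T (isChosen σ) → T (isUsed (proj₁ σ))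
    used-if-chosen σ c with image-elim _≟ˢ_ c
    ... | i , τi , refl = image-intro _≟ᴾ_ i τi

    one-line-through-used : ∀ p → T (isUsed p) → countTrue (base ∘ lineVar p) ≤ 1
    one-line-through-used p u with image-elim _≟ᴾ_ u
    ... | i₀ , τi₀ , refl = countTrue≤1 (base ∘ lineVar p) (slope (line i₀)) (λ s → unique s (lineThrough p s) refl)
      where
      t : Fin k
      t = choice i₀
      unique : ∀ s m → lineThrough p s ≡ m → T (base (maybe (λ L → occupied L) dummy m)) → s ≡ slope (line i₀)
      unique s (just L) through occ with image-elim _≟ᴸ_ occ
      ... | j , τj , refl with lineThrough-just t _ s through
      ...   | refl , meets with line j ≟ᴸ line i₀
      ...     | yes same      = cong slope same
      ...     | no  different = ⊥-elim (choice-unblocked i₀ τi₀ (j , τj , different , meets))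

    satisfies : Sat α formula
    satisfies = All.++⁺ (Sat-⋀⁺ inputs) (All.++⁺ slots (All.++⁺ useds (Sat-⋀⁺ lines)))
      where
      inputs : ∀ i → Sat α (inputClauses i)
      inputs i = ⇒-intro (input i ∷ []) (λ { (τi ∷ []) → image-intro _≟ᴸ_ i τi })
               ∷ ⟹-intro (input i ∷ []) (λ { (τi ∷ []) → Any.tabulate⁺ {f = λ t → pos (chosen (slotOf t i))} (choice i)
                                                             (image-intro _≟ˢ_ {τ = τ} {f = chosenSlot} i τi) })
               ∷ []
      slots : Sat α slotCounter
      slots = Equivalence.from (Sat-embed _ _)
                (SlotCounter.counter-satisfied slotCount (isChosen ∘ slot) (λ _ → refl) (λ _ → refl)
                  (inj₁ (≤-trans (countTrue-image _≟ˢ_ τ chosenSlot slot (λ r r′ → Injection.injective (↔⇒↣ cells↔))) few)))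
      useds : Sat α usedClauses
      useds = All.tabulate⁺ λ r → ⇒-intro (chosen (slot r) ∷ []) λ { (c ∷ []) → used-if-chosen (slot r) c }
      lines : ∀ q → Sat α (lineCounter (point q))
      lines q = Equivalence.from (Sat-embed _ _)
                  (LineCounter.counter-satisfied S (base ∘ lineVar p) (lineVar-base p) (λ _ → refl) bound)
        where
        p : Point
        p = point q
        bound : countTrue (base ∘ lineVar p) ≤ 1 ⊎ SatClause α (neg (used p) ∷ [])
        bound with isUsed p in u
        ... | true  = inj₁ (one-line-through-used p (subst T (sym u) _))
        ... | false = inj₂ (here (subst (T ∘ not) (sym u) _))

  module Bounded (β : Var → Bool) (sat : Sat β formula) where

    τ : Fin n → Bool
    τ = β ∘ input

    private
      sat-inputs : ∀ i → Sat β (inputClauses i)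
      sat-inputs = Sat-⋀⁻ (All.++⁻ˡ (⋀ inputClauses) sat)
      sat-rest : Sat β (slotCounter ++ usedClauses ++ ⋀ (lineCounter ∘ point))
      sat-rest = All.++⁻ʳ (⋀ inputClauses) sat
      sat-slots : Sat β slotCounter
      sat-slots = All.++⁻ˡ slotCounter sat-rest
      sat-useds : Sat β usedClauses
      sat-useds = All.++⁻ˡ usedClauses (All.++⁻ʳ slotCounter sat-rest)
      sat-lines : ∀ q → Sat β (lineCounter (point q))
      sat-lines = Sat-⋀⁻ (All.++⁻ʳ usedClauses (All.++⁻ʳ slotCounter sat-rest))

    occupied-line : ∀ i → T (τ i) → T (β (occupied (line i)))
    occupied-line i τi with sat-inputs i
    ... | c ∷ _ = ⇒-elim (input i ∷ []) c (τi ∷ [])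

    some-slot : ∀ i → T (τ i) → ∃ λ t → T (β (chosen (slotOf t i)))
    some-slot i τi with sat-inputs i
    ... | _ ∷ c ∷ _ = Any.tabulate⁻ {f = λ t → pos (chosen (slotOf t i))} (⟹-elim (input i ∷ []) c (τi ∷ []))

    used-if-chosen : ∀ σ → T (β (chosen σ)) → T (β (used (proj₁ σ)))
    used-if-chosen = ∀-↔ cells↔ λ r c → ⇒-elim (chosen (slot r) ∷ []) (All.tabulate⁻ sat-useds r) (c ∷ [])

    one-line-through-used : ∀ p → T (β (used p)) → countTrue (β ∘ lineVar p) ≤ 1
    one-line-through-used = ∀-↔ *↔× λ q u →
      [ id , (λ ¬u → case ⟹-elim (used (point q) ∷ []) ¬u (u ∷ []) of λ ()) ]′
        (LineCounter.counter-bounded S (Equivalence.to (Sat-embed _ _) (sat-lines q)))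

    few-chosen : countTrue (β ∘ chosen ∘ slot) ≤ k
    few-chosen = [ id , (λ ()) ]′ (SlotCounter.counter-bounded slotCount (Equivalence.to (Sat-embed _ _) sat-slots))

    collision-free : ∀ t {i j} → T (τ i) → T (τ j) → T (β (chosen (slotOf t i))) →
                     height t (line i) ≡ height t (line j) → offset i ≡ offset j → i ≡ j
    collision-free t {i} {j} τi τj c same-height same-offset with line i ≟ᴸ line j
    ... | yes same-line = place-injective i j (cong₂ _,_ same-line same-offset)
    ... | no different = ⊥-elim (<⇒≱ (s≤s ≤-refl) (≤-trans two-lines (one-line-through-used p (used-if-chosen _ c))))
      where
      p : Point
      p = t , height t (line i)
      occupied-through : ∀ {l} → height t l ≡ height t (line i) → lineVar p (slope l) ≡ occupied l
      occupied-through {l} e = subst (λ v → lineVar (t , v) (slope l) ≡ occupied l) e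
                                     (cong (maybe (λ L → occupied L) dummy) (lineThrough-height t l))
      two-lines : 2 ≤ countTrue (β ∘ lineVar p)
      two-lines = 2≤countTrue (β ∘ lineVar p) (λ same-slope → different (parallel-lines t same-slope same-height))
                    (subst (T ∘ β) (sym (occupied-through refl)) (occupied-line i τi))
                    (subst (T ∘ β) (sym (occupied-through (sym same-height))) (occupied-line j τj))

    bounded : countTrue τ ≤ k
    bounded = ≤-trans (countTrue-mono-injective τ (β ∘ chosen ∘ slot) key chosen-key key-injective) few-chosen
      where
      key : ∀ i → T (τ i) → Fin slotCount
      key i τi = Inverse.from cells↔ (slotOf (proj₁ (some-slot i τi)) i)
      chosen-key : ∀ i τi → T (β (chosen (slot (key i τi))))
      chosen-key i τi = subst (T ∘ β ∘ chosen) (sym (Inverse.strictlyInverseˡ cells↔ _)) (proj₂ (some-slot i τi))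
      key-injective : ∀ i j τi τj → key i τi ≡ key j τj → i ≡ j
      key-injective i j τi τj e with some-slot i τi | some-slot j τj
      ... | t , c | t′ , _ = same-slot t t′ c (Injection.injective (↔⇒↣ (↔-sym cells↔)) {slotOf t i} {slotOf t′ j} e)
        where
        same-slot : ∀ t t′ → T (β (chosen (slotOf t i))) → slotOf t i ≡ slotOf t′ j → i ≡ j
        same-slot t t′ c e with cong (proj₁ ∘ proj₁) e
        ... | refl = collision-free t τi τj c (cong (proj₂ ∘ proj₁) e) (cong proj₂ e)

  formula-encodes : Encodes k formula
  formula-encodes τ = mk⇔ (λ few → Satisfying.assignment τ few , Satisfying.satisfies τ few)
                          (λ (β , sat) → Bounded.bounded [ τ , β ]′ sat)

^-distribʳ-* : ∀ m n o → (m * n) ^ o ≡ m ^ o * n ^ o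
^-distribʳ-* m n zero    = refl
^-distribʳ-* m n (suc o) = trans (cong (m * n *_) (^-distribʳ-* m n o)) (interchange m n (m ^ o) (n ^ o))
  where
  interchange : ∀ a b c d → a * b * (c * d) ≡ a * c * (b * d)
  interchange = solve-∀

power-bound : ∀ {X c n g} k → X * suc g ≤ c * n → n ≤ suc g ^ (k + 1) → X ^ (k + 1) ≤ c ^ (k + 1) * n ^ k
power-bound {X} {c} {n} {g} k Xg≤cn n≤g^e = *-cancelʳ-≤ (X ^ e) (c ^ e * n ^ k) (suc g ^ e) {{m^n≢0 (suc g) e}} (begin
  X ^ e * suc g ^ e            ≡⟨ ^-distribʳ-* X (suc g) e ⟨
  (X * suc g) ^ e              ≤⟨ ^-monoˡ-≤ e Xg≤cn ⟩
  (c * n) ^ e                  ≡⟨ ^-distribʳ-* c n e ⟩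
  c ^ e * n ^ e                ≡⟨ cong (c ^ e *_) (trans (^-distribˡ-+-* n k 1) (cong (n ^ k *_) (*-identityʳ n))) ⟩
  c ^ e * (n ^ k * n)          ≤⟨ *-monoʳ-≤ (c ^ e) (*-monoʳ-≤ (n ^ k) n≤g^e) ⟩
  c ^ e * (n ^ k * suc g ^ e)  ≡⟨ *-assoc (c ^ e) (n ^ k) (suc g ^ e) ⟨
  c ^ e * n ^ k * suc g ^ e    ∎)
  where
  open ≤-Reasoning
  e : ℕ
  e = k + 1

integer-root : ∀ e n → 0 < e → 0 < n → ∃ λ h → h ^ e < n × n ≤ suc h ^ e
integer-root (suc e) (suc zero)    _ _ = 0 , z<s , ≤-reflexive (sym (^-zeroˡ (suc e)))
integer-root (suc e) (suc (suc n)) _ _ with integer-root (suc e) (suc n) z<s z<s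
... | h , h^e<n , n≤[1+h]^e with suc (suc n) ≤? suc h ^ suc e
...   | yes fits  = h , ≤-trans h^e<n (n≤1+n _) , fits
...   | no  ¬fits = suc h , ≰⇒> ¬fits , ≤-trans (s≤s n≤[1+h]^e) (^-monoˡ-< (suc e) (n<1+n (suc h)))

suc≤2^ : ∀ m → suc m ≤ 2 ^ m
suc≤2^ zero    = ≤-refl
suc≤2^ (suc m) = begin
  1 + suc m     ≤⟨ +-mono-≤ (m^n>0 2 m) (suc≤2^ m) ⟩
  2 ^ m + 2 ^ m ≡⟨ cong (2 ^ m +_) (+-identityʳ (2 ^ m)) ⟨
  2 * 2 ^ m     ∎
  where open ≤-Reasoning

^-suc+1 : ∀ h j → h ^ (suc j + 1) ≡ h ^ j * (h * h)
^-suc+1 h j = trans (cong (h *_) (^-distribˡ-+-* h j 1)) (rearrange h (h ^ j))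
  where
  rearrange : ∀ h x → h * (x * (h * 1)) ≡ x * (h * h)
  rearrange = solve-∀

suc-square≤ : ∀ {h} → 1 ≤ h → suc h * suc h ≤ 4 * (h * h)
suc-square≤ {h} 1≤h = begin
  suc h * suc h     ≤⟨ *-mono-≤ (+-monoˡ-≤ h 1≤h) (+-monoˡ-≤ h 1≤h) ⟩
  (h + h) * (h + h) ≡⟨ expand h ⟩
  4 * (h * h)       ∎
  where
  open ≤-Reasoning
  expand : ∀ h → (h + h) * (h + h) ≡ 4 * (h * h)
  expand = solve-∀

suc-cube≤ : ∀ {h} → 1 ≤ h → suc h * suc h * suc h ≤ 8 * (h * h * h)
suc-cube≤ {h} 1≤h = begin
  suc h * suc h * suc h         ≤⟨ *-mono-≤ (*-mono-≤ h+1≤2h h+1≤2h) h+1≤2h ⟩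
  (h + h) * (h + h) * (h + h)   ≡⟨ expand h ⟩
  8 * (h * h * h)               ∎
  where
  open ≤-Reasoning
  h+1≤2h : suc h ≤ h + h
  h+1≤2h = +-monoˡ-≤ h 1≤h
  expand : ∀ h → (h + h) * (h + h) * (h + h) ≡ 8 * (h * h * h)
  expand = solve-∀

cube≤8^ : ∀ {h} j → 8 ≤ h → suc (suc j) * suc (suc j) * suc (suc j) ≤ 8 * h ^ j
cube≤8^ zero    8≤h = ≤-refl
cube≤8^ {h} (suc j) 8≤h = begin
  x * x * x                 ≤⟨ suc-cube≤ {y} (s≤s z≤n) ⟩
  8 * (y * y * y)           ≤⟨ *-monoʳ-≤ 8 (cube≤8^ j 8≤h) ⟩
  8 * (8 * h ^ j)           ≤⟨ *-monoʳ-≤ 8 (*-monoˡ-≤ (h ^ j) 8≤h) ⟩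
  8 * h ^ suc j             ∎
  where
  open ≤-Reasoning
  y x : ℕ
  y = suc (suc j)
  x = suc y

square-bound : ∀ {h} k′ → 2 ≤ h → suc k′ * (suc h * suc h) ≤ 4 * h ^ (suc k′ + 1)
square-bound {h} k′ 2≤h = begin
  suc k′ * (suc h * suc h) ≤⟨ *-mono-≤ (≤-trans (suc≤2^ k′) (^-monoˡ-≤ k′ 2≤h)) (suc-square≤ (≤-trans (s≤s z≤n) 2≤h)) ⟩
  h ^ k′ * (4 * (h * h))   ≡⟨ rearrange (h ^ k′) h ⟩
  4 * (h ^ k′ * (h * h))   ≡⟨ cong (4 *_) (^-suc+1 h k′) ⟨
  4 * h ^ (suc k′ + 1)     ∎
  where
  open ≤-Reasoning
  rearrange : ∀ x h → x * (4 * (h * h)) ≡ 4 * (x * (h * h))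
  rearrange = solve-∀

cube-bound : ∀ {h} k′ → 8 ≤ h → suc k′ * suc k′ * k′ * (suc h * suc h * suc h) ≤ 64 * h ^ (suc k′ + 1)
cube-bound zero        8≤h = z≤n
cube-bound {h} (suc j) 8≤h = begin
  k * k * suc j * g³                ≤⟨ *-monoˡ-≤ g³ (*-monoʳ-≤ (k * k) (n≤1+n (suc j))) ⟩
  k * k * k * g³                    ≤⟨ *-mono-≤ (cube≤8^ j 8≤h) (suc-cube≤ (≤-trans (s≤s z≤n) 8≤h)) ⟩
  8 * h ^ j * (8 * (h * h * h))     ≡⟨ rearrange (h ^ j) h ⟩
  64 * (h * (h ^ j * (h * h)))      ≡⟨ cong (λ x → 64 * (h * x)) (^-suc+1 h j) ⟨
  64 * h ^ (suc (suc j) + 1)        ∎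
  where
  open ≤-Reasoning
  k g³ : ℕ
  k = suc (suc j)
  g³ = suc h * suc h * suc h
  rearrange : ∀ x h → 8 * x * (8 * (h * h * h)) ≡ 64 * (h * (x * (h * h)))
  rearrange = solve-∀

EncodingWithin : (k n g c : ℕ) → Set
EncodingWithin k n g c = ∃ λ m → ∃ λ (φ : CNF (Fin n ⊎ Fin m)) →
  EncodesAtMostK k n m φ × (size φ ∸ 2 * n) * g ≤ c * n × m * g ≤ c * n

counter-encodes : ∀ n k′ → Encodes (suc k′) (SequentialCounter.counter k′ n id [])
counter-encodes n k′ τ = mk⇔ (λ few → registers τ , counter-satisfied n τ (λ _ → refl) (λ _ → refl) (inj₁ few))
                             (λ (β , s) → [ id , (λ ()) ]′ (counter-bounded n s))
  where open SequentialCounter k′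

counter-within : ∀ n k′ g → g ≤ 8 → EncodingWithin (suc k′) n g (483 * suc k′)
counter-within n k′ g g≤8 =
  n * k , φ′ , Encodes⇒EncodesAtMostK (↔-sym *↔×) (counter-encodes n k′) , excess , aux
  where
  open SequentialCounter k′ using (Register; counter; size-counter)
  k : ℕ
  k = suc k′
  φ : CNF (Fin n ⊎ Register n)
  φ = counter n id []
  φ′ : CNF (Fin n ⊎ Fin (n * k))
  φ′ = rename (map₂ (Inverse.to (↔-sym *↔×))) φ
  excess : (size φ′ ∸ 2 * n) * g ≤ 483 * k * n
  excess = begin
    (size φ′ ∸ 2 * n) * g           ≤⟨ *-mono-≤ (≤-trans (m∸n≤m (size φ′) (2 * n)) (≤-reflexive (size-rename _ φ))) g≤8 ⟩
    size φ * 8                      ≤⟨ *-monoˡ-≤ 8 (size-counter n id []) ⟩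
    n * (2 * k + 1) * 8             ≤⟨ m≤m+n _ _ ⟩
    n * (2 * k + 1) * 8 + (459 * (k * n) + 8 * (k′ * n)) ≡⟨ identity k′ n ⟩
    483 * k * n                     ∎
    where
    open ≤-Reasoning
    identity : ∀ k′ n → n * (2 * suc k′ + 1) * 8 + (459 * (suc k′ * n) + 8 * (k′ * n)) ≡ 483 * suc k′ * n
    identity = solve-∀
  aux : n * k * g ≤ 483 * k * n
  aux = begin
    n * k * g                       ≤⟨ *-monoʳ-≤ (n * k) g≤8 ⟩
    n * k * 8                       ≤⟨ m≤m+n _ _ ⟩
    n * k * 8 + 475 * (k * n)       ≡⟨ identity k n ⟩
    483 * k * n                     ∎
    where
    open ≤-Reasoning
    identity : ∀ k n → n * k * 8 + 475 * (k * n) ≡ 483 * k * n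
    identity = solve-∀

-- k·g slopes, g offsets and q intercepts give q·(k·g)·g ≥ n positions, while the
-- k·P·g slots (times g) stay below 69·n; hence the constant 483 = 7 · 69.
module BalancedGrid (n k′ h : ℕ) (8≤h : 8 ≤ h) (h^e<n : h ^ (suc k′ + 1) < n) where

  k g d q : ℕ
  k = suc k′
  g = suc h
  d = k * (g * g)
  q = suc (n / d)

  n<qd : n < q * d
  n<qd = begin-strict
    n                     ≡⟨ m≡m%n+[m/n]*n n d ⟩
    n % d + n / d * d     <⟨ +-monoˡ-< (n / d * d) (m%n<n n d) ⟩
    q * d                 ∎
    where open ≤-Reasoning

  qd≤n+d : q * d ≤ n + d
  qd≤n+d = subst (_≤ n + d) (+-comm (n / d * d) d) (+-monoˡ-≤ d (m/n*n≤m n d))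

  n≤ASℓ : n ≤ q * (k * g) * g
  n≤ASℓ = subst (n ≤_) (reassociate q k g) (<⇒≤ n<qd)
    where
    reassociate : ∀ q k g → q * (k * (g * g)) ≡ q * (k * g) * g
    reassociate = solve-∀

  open GridEncoding n k′ q (k * g) g n≤ASℓ hiding (k)

  Z : ℕ
  Z = slotCount * g

  d≤4n : d ≤ 4 * n
  d≤4n = ≤-trans (square-bound k′ (≤-trans (s≤s (s≤s z≤n)) 8≤h)) (*-monoʳ-≤ 4 (<⇒≤ h^e<n))

  Z≤69n : Z ≤ 69 * n
  Z≤69n = begin
    Z                                       ≡⟨ split q k′ g ⟩
    q * d + k * k * k′ * (g * g * g)        ≤⟨ +-mono-≤ qd≤n+d (cube-bound k′ 8≤h) ⟩
    n + d + 64 * h ^ (k + 1)                ≤⟨ +-mono-≤ (+-monoʳ-≤ n d≤4n) (*-monoʳ-≤ 64 (<⇒≤ h^e<n)) ⟩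
    n + 4 * n + 64 * n                      ≡⟨ collect n ⟩
    69 * n                                  ∎
    where
    open ≤-Reasoning
    split : ∀ q k′ g → suc k′ * (q + suc k′ * g * k′) * g * g ≡ q * (suc k′ * (g * g)) + suc k′ * suc k′ * k′ * (g * g * g)
    split = solve-∀
    collect : ∀ n → n + 4 * n + 64 * n ≡ 69 * n
    collect = solve-∀

  φ : CNF (Fin n ⊎ Fin auxCount)
  φ = rename (map₂ (Inverse.to aux↔)) formula

  g≤n : g ≤ n
  g≤n = ≤-trans (s≤s h≤h^e) h^e<n
    where
    h≤h^e : h ≤ h ^ (k + 1)
    h≤h^e = subst (_≤ h ^ (k + 1)) (*-identityʳ h) (^-monoʳ-≤ h {{>-nonZero (≤-trans (s≤s z≤n) 8≤h)}} {1} {k + 1} (s≤s z≤n))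

  excess-bound : (size φ ∸ 2 * n) * g ≤ 483 * k * n
  excess-bound = begin
    (size φ ∸ 2 * n) * g      ≤⟨ *-monoˡ-≤ g (∸-monoˡ-≤ (2 * n) (≤-trans (≤-reflexive (size-rename _ formula)) size-formula)) ⟩
    (2 * n + E ∸ 2 * n) * g   ≡⟨ cong (_* g) (m+n∸m≡n (2 * n) E) ⟩
    E * g                     ≡⟨ factor k′ q g ⟩
    (5 * k + 2) * Z           ≤⟨ *-monoˡ-≤ Z (≤-trans (m≤m+n (5 * k + 2) (2 * k′)) (≤-reflexive (five-two k′))) ⟩
    7 * k * Z                 ≤⟨ *-monoʳ-≤ (7 * k) Z≤69n ⟩
    7 * k * (69 * n)          ≡⟨ collect k n ⟩
    483 * k * n               ∎
    where
    open ≤-Reasoning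
    E : ℕ
    E = slotCount * (2 * k + 1) + (slotCount + k * P * (k * g * 3))
    factor : ∀ k′ q g → let k = suc k′ ; P = q + k * g * k′ in
      (k * P * g * (2 * k + 1) + (k * P * g + k * P * (k * g * 3))) * g ≡ (5 * k + 2) * (k * P * g * g)
    factor = solve-∀
    five-two : ∀ k′ → 5 * suc k′ + 2 + 2 * k′ ≡ 7 * suc k′
    five-two = solve-∀
    collect : ∀ k n → 7 * k * (69 * n) ≡ 483 * k * n
    collect = solve-∀

  aux-bound : auxCount * g ≤ 483 * k * n
  aux-bound = begin
    auxCount * g                                      ≡⟨ split k′ q g ⟩
    q * d + (Z + (k * P * g + (g + 2 * k * Z)))       ≤⟨ +-mono-≤ (≤-trans qd≤n+d (+-monoʳ-≤ n d≤4n))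
                                                           (+-mono-≤ Z≤69n (+-mono-≤ (≤-trans (m≤m*n (k * P * g) g) Z≤69n)
                                                             (+-mono-≤ g≤n (*-monoʳ-≤ (2 * k) Z≤69n)))) ⟩
    n + 4 * n + (69 * n + (69 * n + (n + 2 * k * (69 * n))))  ≤⟨ m≤m+n _ (201 * (k * n) + 144 * (k′ * n)) ⟩
    n + 4 * n + (69 * n + (69 * n + (n + 2 * k * (69 * n)))) + (201 * (k * n) + 144 * (k′ * n)) ≡⟨ collect k′ n ⟩
    483 * k * n                                       ∎
    where
    open ≤-Reasoning
    split : ∀ k′ q g → let k = suc k′ ; P = q + k * g * k′ in
      (q * (k * g) + (k * P * g + (k * P + (1 + (k * P * g * k + k * P * (k * g * 1)))))) * g
        ≡ q * (k * (g * g)) + (k * P * g * g + (k * P * g + (g + 2 * k * (k * P * g * g))))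
    split = solve-∀
    collect : ∀ k′ n → let k = suc k′ in
      n + 4 * n + (69 * n + (69 * n + (n + 2 * k * (69 * n)))) + (201 * (k * n) + 144 * (k′ * n)) ≡ 483 * k * n
    collect = solve-∀

  within : EncodingWithin k n g (483 * k)
  within = auxCount , φ , Encodes⇒EncodesAtMostK aux↔ formula-encodes , excess-bound , aux-bound

encoding-within : ∀ n k h → 0 < k → h ^ (k + 1) < n → EncodingWithin k n (suc h) (483 * k)
encoding-within n (suc k′) h _ h^e<n with 8 ≤? h
... | yes 8≤h = BalancedGrid.within n k′ h 8≤h h^e<n
... | no  h≱8 = counter-within n k′ (suc h) (≰⇒> h≱8)

theorem11 : ∃ λ (C : ℕ) → ∀ (n k : ℕ) → .{{_ : NonZero n}} → .{{_ : NonZero k}} →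
    ∃ λ (m : ℕ) → ∃ λ (φ : CNF (Fin n ⊎ Fin m)) →
      EncodesAtMostK k n m φ
      × (size φ ∸ 2 * n) ^ (k + 1) ≤ (C * k) ^ (k + 1) * n ^ k
      × m ^ (k + 1) ≤ (C * k) ^ (k + 1) * n ^ k
theorem11 = 483 , λ n k →
  let h , h^e<n , n≤g^e        = integer-root (k + 1) n (m≤n+m 1 k) (>-nonZero⁻¹ n)
      m , φ , encodes , φ≤ , m≤ = encoding-within n k h (>-nonZero⁻¹ k) h^e<n
  in m , φ , encodes , power-bound k φ≤ n≤g^e , power-bound k m≤ n≤g^e
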